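{- Let $n\ge5$ be an odd integer and $\rho$ a root of $f_n(X)=X^3+nX^2+nX-1$, $K=\mathbb{Q}(\rho)$. Then $\mu=\frac{n+3}{2}(1+\rho)+\rho^2$ is a unit of $\mathcal{O}_K$ with $N_{K|\mathbb{Q}}(\mu)=1$. -}

module Defs where

open import Data.Nat using (ℕ)
open import Data.Integer using (ℤ; +_)
open import Data.Rational using (ℚ; _/_; 0ℚ; 1ℚ; _+_; _*_; _-_; -_)
open import Data.List using (List; []; _∷_)
open import Data.Product using (Σ; ∃; _×_; _,_)
open import Relation.Binary.PropositionalEquality using (_≡_)

-- K = ℚ(ρ) is modelled as ℚ[X]/(f_n), an element a₀ + a₁ρ + a₂ρ² being
-- the triple (a₀ , a₁ , a₂) of (normalised) rationals.

record K : Set where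
  constructor ⟨_,_,_⟩
  field
    c₀ c₁ c₂ : ℚ
open K public

ℕ→ℚ : ℕ → ℚ
ℕ→ℚ m = + m / 1

ℤ→ℚ : ℤ → ℚ
ℤ→ℚ z = z / 1

module _ (n : ℕ) where
  private
    N : ℚ
    N = ℕ→ℚ n

  zeroK : K
  zeroK = ⟨ 0ℚ , 0ℚ , 0ℚ ⟩

  oneK : K
  oneK = ⟨ 1ℚ , 0ℚ , 0ℚ ⟩

  ρK : K
  ρK = ⟨ 0ℚ , 1ℚ , 0ℚ ⟩

  addK : K → K → K
  addK ⟨ a₀ , a₁ , a₂ ⟩ ⟨ b₀ , b₁ , b₂ ⟩ = ⟨ a₀ + b₀ , a₁ + b₁ , a₂ + b₂ ⟩

  -- multiplication: multiply as polynomials (degrees 0..4), then reduce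
  -- ρ⁴ = ρ · ρ³ = ρ - nρ² - nρ³ and ρ³ = 1 - nρ - nρ².
  mulK : K → K → K
  mulK ⟨ a₀ , a₁ , a₂ ⟩ ⟨ b₀ , b₁ , b₂ ⟩ =
    let d₀ = a₀ * b₀
        d₁ = a₀ * b₁ + a₁ * b₀
        d₂ = a₀ * b₂ + a₁ * b₁ + a₂ * b₀
        d₃ = a₁ * b₂ + a₂ * b₁
        d₄ = a₂ * b₂
        -- eliminate ρ⁴
        e₁ = d₁ + d₄
        e₂ = d₂ - N * d₄
        e₃ = d₃ - N * d₄
        -- eliminate ρ³
    in ⟨ d₀ + e₃ , e₁ - N * e₃ , e₂ - N * e₃ ⟩

  -- evaluation of the monic polynomial X^d + c₁ X^(d-1) + ... + c_d
  -- (coefficient list [c₁, …, c_d]) at x, by Horner's scheme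
  evalMonic : List ℤ → K → K
  evalMonic cs x = go oneK cs
    where
      go : K → List ℤ → K
      go acc [] = acc
      go acc (c ∷ cs') = go (addK (mulK acc x) ⟨ ℤ→ℚ c , 0ℚ , 0ℚ ⟩) cs'

  InOK : K → Set
  InOK x = Σ (List ℤ) λ cs → evalMonic cs x ≡ zeroK

  IsUnitOK : K → Set
  IsUnitOK x = InOK x × Σ K λ y → InOK y × mulK x y ≡ oneK

  -- N_{K|ℚ}(x) = determinant of the ℚ-linear map "multiplication by x"
  -- on K, in the basis 1, ρ, ρ².
  det3 : K → K → K → ℚ
  det3 ⟨ a₀ , a₁ , a₂ ⟩ ⟨ b₀ , b₁ , b₂ ⟩ ⟨ c₀' , c₁' , c₂' ⟩ =
      a₀ * (b₁ * c₂' - c₁' * b₂)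
    - b₀ * (a₁ * c₂' - c₁' * a₂)
    + c₀' * (a₁ * b₂ - b₁ * a₂)

  normK : K → ℚ
  normK x = det3 (mulK x oneK) (mulK x ρK) (mulK x (mulK ρK ρK))

  μK : K
  μK = ⟨ + (n Data.Nat.+ 3) / 2 , + (n Data.Nat.+ 3) / 2 , 1ℚ ⟩

module Submission where

-- Write n = 2k + 1, so that μ = (k + 2)(1 + ρ) + ρ².  Everything about μ is then a
-- polynomial identity in k inside ℚ[k][ρ]/(f_n): μ has the explicit inverse
-- μ⁻¹ = (k² − k) + (3k − 2k³)ρ + (1 − k²)ρ², its norm is 1, and it is a root of
-- X³ − tr(μ) X² + tr(μ⁻¹) X − 1, whose coefficients tr(μ) = 2k² − 2k + 3 and
-- tr(μ⁻¹) = 2k³ + 2k² − 6k − 1 are integers; μ⁻¹ is a root of the reversed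
-- polynomial.  These identities are checked by the ring solver over ℚ[k]; the
-- integrality of the coefficients comes from computing them in ℤ and mapping
-- the computation along the ring homomorphism ℤ → ℚ.

open import Defs
open import Algebra.Bundles using (CommutativeRing)
open import Algebra.Bundles.Raw using (RawRing)
import Algebra.Definitions.RawSemiring as RawSemiringDefinitions
open import Algebra.Solver.Ring.AlmostCommutativeRing using (fromCommutativeRing)
import Algebra.Solver.Ring.Simple as Simple
import Data.Fin as Fin
open import Data.Integer as ℤ using (ℤ; +_)
import Data.Integer.Properties as ℤ
open import Data.List as List using (List; []; _∷_)
import Data.List.Properties as List
open import Data.Nat as ℕ using (ℕ; _≤_; _%_)
open import Data.Nat.DivMod using (m≡m%n+[m/n]*n)
open import Data.Nat.Tactic.RingSolver using (solve-∀)
open import Data.Product using (_×_; _,_; proj₁; proj₂)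
open import Data.Rational as ℚ using (ℚ; 1ℚ; toℚᵘ)
import Data.Rational.Properties as ℚ
open import Data.Rational.Unnormalised as ℚᵘ using (mkℚᵘ; *≡*)
import Data.Rational.Unnormalised.Properties as ℚᵘ
open import Data.Vec as Vec using (Vec; _∷_; [])
import Data.Vec.Properties as Vec
open import Function using (_∘_)
open import Level using (0ℓ)
open import Relation.Binary.Definitions using (Decidable)
open import Relation.Binary.PropositionalEquality
  using (_≡_; refl; sym; trans; cong; cong₂; subst; module ≡-Reasoning)

toℚᵘ-ℤ→ℚ : ∀ z → toℚᵘ (ℤ→ℚ z) ℚᵘ.≃ mkℚᵘ z 0
toℚᵘ-ℤ→ℚ z = ℚ.toℚᵘ-fromℚᵘ (mkℚᵘ z 0)

ℤ→ℚ-homo-+ : ∀ a b → ℤ→ℚ (a ℤ.+ b) ≡ ℤ→ℚ a ℚ.+ ℤ→ℚ b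
ℤ→ℚ-homo-+ a b = ℚ.toℚᵘ-injective (begin-equality
  toℚᵘ (ℤ→ℚ (a ℤ.+ b))            ≃⟨ toℚᵘ-ℤ→ℚ (a ℤ.+ b) ⟩
  mkℚᵘ (a ℤ.+ b) 0                ≃⟨ *≡* (cong (ℤ._* + 1) (cong₂ ℤ._+_ (sym (ℤ.*-identityʳ a))
                                                                       (sym (ℤ.*-identityʳ b)))) ⟩
  mkℚᵘ a 0 ℚᵘ.+ mkℚᵘ b 0          ≃⟨ ℚᵘ.+-cong (toℚᵘ-ℤ→ℚ a) (toℚᵘ-ℤ→ℚ b) ⟨
  toℚᵘ (ℤ→ℚ a) ℚᵘ.+ toℚᵘ (ℤ→ℚ b)  ≃⟨ ℚ.toℚᵘ-homo-+ (ℤ→ℚ a) (ℤ→ℚ b) ⟨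
  toℚᵘ (ℤ→ℚ a ℚ.+ ℤ→ℚ b)          ∎)
  where open ℚᵘ.≤-Reasoning

ℤ→ℚ-homo-* : ∀ a b → ℤ→ℚ (a ℤ.* b) ≡ ℤ→ℚ a ℚ.* ℤ→ℚ b
ℤ→ℚ-homo-* a b = ℚ.toℚᵘ-injective (begin-equality
  toℚᵘ (ℤ→ℚ (a ℤ.* b))            ≃⟨ toℚᵘ-ℤ→ℚ (a ℤ.* b) ⟩
  mkℚᵘ a 0 ℚᵘ.* mkℚᵘ b 0          ≃⟨ ℚᵘ.*-cong (toℚᵘ-ℤ→ℚ a) (toℚᵘ-ℤ→ℚ b) ⟨
  toℚᵘ (ℤ→ℚ a) ℚᵘ.* toℚᵘ (ℤ→ℚ b)  ≃⟨ ℚ.toℚᵘ-homo-* (ℤ→ℚ a) (ℤ→ℚ b) ⟨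
  toℚᵘ (ℤ→ℚ a ℚ.* ℤ→ℚ b)          ∎)
  where open ℚᵘ.≤-Reasoning

ℤ→ℚ-homo‿- : ∀ a → ℤ→ℚ (ℤ.- a) ≡ ℚ.- ℤ→ℚ a
ℤ→ℚ-homo‿- a = ℚ.toℚᵘ-injective (begin-equality
  toℚᵘ (ℤ→ℚ (ℤ.- a))              ≃⟨ toℚᵘ-ℤ→ℚ (ℤ.- a) ⟩
  ℚᵘ.- mkℚᵘ a 0                   ≃⟨ ℚᵘ.-‿cong (toℚᵘ-ℤ→ℚ a) ⟨
  ℚᵘ.- toℚᵘ (ℤ→ℚ a)               ≃⟨ ℚ.toℚᵘ-homo‿- (ℤ→ℚ a) ⟨
  toℚᵘ (ℚ.- ℤ→ℚ a)                ∎)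
  where open ℚᵘ.≤-Reasoning

module ℤ^ = RawSemiringDefinitions ℤ.+-*-rawSemiring
module ℚ^ = RawSemiringDefinitions ℚ.+-*-rawSemiring

ℤ→ℚ-homo-^ : ∀ a e → ℤ→ℚ (a ℤ^.^ e) ≡ ℤ→ℚ a ℚ^.^ e
ℤ→ℚ-homo-^ a ℕ.zero    = refl
ℤ→ℚ-homo-^ a (ℕ.suc e) = trans (ℤ→ℚ-homo-* a (a ℤ^.^ e)) (cong (ℤ→ℚ a ℚ.*_) (ℤ→ℚ-homo-^ a e))

module PolynomialSyntax (R : CommutativeRing 0ℓ 0ℓ)
                        (_≟_ : Decidable (CommutativeRing._≈_ R)) where
  open Simple (fromCommutativeRing R) _≟_ public
  open CommutativeRing R using (0#; 1#)

  rawRing : ℕ → RawRing 0ℓ 0ℓ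
  rawRing m = record
    { Carrier = Polynomial m
    ; _≈_     = _≡_
    ; _+_     = _:+_
    ; _*_     = _:*_
    ; -_      = :-_
    ; 0#      = con 0#
    ; 1#      = con 1#
    }

module ℤ[X] = PolynomialSyntax ℤ.+-*-commutativeRing ℤ._≟_
module ℚ[X] = PolynomialSyntax ℚ.+-*-commutativeRing ℚ._≟_

ℤ→ℚ[X] : ∀ {m} → ℤ[X].Polynomial m → ℚ[X].Polynomial m
ℤ→ℚ[X] (ℤ[X].op ℤ[X].[+] p q) = ℤ→ℚ[X] p ℚ[X].:+ ℤ→ℚ[X] q
ℤ→ℚ[X] (ℤ[X].op ℤ[X].[*] p q) = ℤ→ℚ[X] p ℚ[X].:* ℤ→ℚ[X] q
ℤ→ℚ[X] (ℤ[X].con c)           = ℚ[X].con (ℤ→ℚ c)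
ℤ→ℚ[X] (ℤ[X].var i)           = ℚ[X].var i
ℤ→ℚ[X] (p ℤ[X].:^ e)          = ℤ→ℚ[X] p ℚ[X].:^ e
ℤ→ℚ[X] (ℤ[X].:- p)            = ℚ[X].:- ℤ→ℚ[X] p

ℤ→ℚ-⟦⟧ : ∀ {m} (p : ℤ[X].Polynomial m) (env : Vec ℤ m) →
         ℤ→ℚ (ℤ[X].⟦ p ⟧ env) ≡ ℚ[X].⟦ ℤ→ℚ[X] p ⟧ (Vec.map ℤ→ℚ env)
ℤ→ℚ-⟦⟧ (ℤ[X].op ℤ[X].[+] p q) env =
  trans (ℤ→ℚ-homo-+ (ℤ[X].⟦ p ⟧ env) (ℤ[X].⟦ q ⟧ env)) (cong₂ ℚ._+_ (ℤ→ℚ-⟦⟧ p env) (ℤ→ℚ-⟦⟧ q env))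
ℤ→ℚ-⟦⟧ (ℤ[X].op ℤ[X].[*] p q) env =
  trans (ℤ→ℚ-homo-* (ℤ[X].⟦ p ⟧ env) (ℤ[X].⟦ q ⟧ env)) (cong₂ ℚ._*_ (ℤ→ℚ-⟦⟧ p env) (ℤ→ℚ-⟦⟧ q env))
ℤ→ℚ-⟦⟧ (ℤ[X].con c)   env = refl
ℤ→ℚ-⟦⟧ (ℤ[X].var i)   env = sym (Vec.lookup-map i ℤ→ℚ env)
ℤ→ℚ-⟦⟧ (p ℤ[X].:^ e)  env = trans (ℤ→ℚ-homo-^ (ℤ[X].⟦ p ⟧ env) e) (cong (ℚ^._^ e) (ℤ→ℚ-⟦⟧ p env))
ℤ→ℚ-⟦⟧ (ℤ[X].:- p)    env = trans (ℤ→ℚ-homo‿- (ℤ[X].⟦ p ⟧ env)) (cong ℚ.-_ (ℤ→ℚ-⟦⟧ p env))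

ℤ→ℚ-⟦⟧-map : ∀ {m} (ps : List (ℤ[X].Polynomial m)) (env : Vec ℤ m) →
             List.map ℤ→ℚ (List.map (λ p → ℤ[X].⟦ p ⟧ env) ps) ≡
             List.map (λ p → ℚ[X].⟦ ℤ→ℚ[X] p ⟧ (Vec.map ℤ→ℚ env)) ps
ℤ→ℚ-⟦⟧-map ps env = trans (sym (List.map-∘ ps)) (List.map-cong (λ p → ℤ→ℚ-⟦⟧ p env) ps)

Triple : Set → Set
Triple A = A × A × A

map³ : {A B : Set} → (A → B) → Triple A → Triple B
map³ f (a₀ , a₁ , a₂) = f a₀ , f a₁ , f a₂

toK : Triple ℚ → K
toK (a₀ , a₁ , a₂) = ⟨ a₀ , a₁ , a₂ ⟩

⟦_⟧³ : ∀ {m} → Triple (ℚ[X].Polynomial m) → ℚ[X].Env m → Triple ℚ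
⟦ x ⟧³ env = map³ (λ p → ℚ[X].⟦ p ⟧ env) x

normalise-sound : ∀ {m} (env : ℚ[X].Env m) (p q : ℚ[X].Polynomial m) →
                  ℚ[X].normalise p ≡ ℚ[X].normalise q → ℚ[X].⟦ p ⟧ env ≡ ℚ[X].⟦ q ⟧ env
normalise-sound env p q eq = ℚ[X].prove env p q (cong (λ r → ℚ[X].⟦ r ⟧N env) eq)

normalise³-sound : ∀ {m} (env : ℚ[X].Env m) (x y : Triple (ℚ[X].Polynomial m)) →
                   map³ ℚ[X].normalise x ≡ map³ ℚ[X].normalise y → ⟦ x ⟧³ env ≡ ⟦ y ⟧³ env
normalise³-sound env (x₀ , x₁ , x₂) (y₀ , y₁ , y₂) eq =
  cong₂ _,_ (normalise-sound env x₀ y₀ (cong proj₁ eq))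
  (cong₂ _,_ (normalise-sound env x₁ y₁ (cong (proj₁ ∘ proj₂) eq))
             (normalise-sound env x₂ y₂ (cong (proj₂ ∘ proj₂) eq)))

-- The
-- formulas are literally those of Defs, so for R = ℚ and N = ℕ→ℚ n they agree
-- definitionally with mulK, evalMonic and normK.
module CubicArithmetic (R : RawRing 0ℓ 0ℓ) where
  open RawRing R

  infixl 6 _-_
  _-_ : Carrier → Carrier → Carrier
  x - y = x + - y

  zero one ρ : Triple Carrier
  zero = 0# , 0# , 0#
  one  = 1# , 0# , 0#
  ρ    = 0# , 1# , 0#

  _⊕_ : Triple Carrier → Triple Carrier → Triple Carrier
  (a₀ , a₁ , a₂) ⊕ (b₀ , b₁ , b₂) = a₀ + b₀ , a₁ + b₁ , a₂ + b₂

  determinant : Triple Carrier → Triple Carrier → Triple Carrier → Carrier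
  determinant (a₀ , a₁ , a₂) (b₀ , b₁ , b₂) (c₀ , c₁ , c₂) =
      a₀ * (b₁ * c₂ - c₁ * b₂)
    - b₀ * (a₁ * c₂ - c₁ * a₂)
    + c₀ * (a₁ * b₂ - b₁ * a₂)

  module _ (N : Carrier) where
    mul : Triple Carrier → Triple Carrier → Triple Carrier
    mul (a₀ , a₁ , a₂) (b₀ , b₁ , b₂) =
      let d₀ = a₀ * b₀
          d₁ = a₀ * b₁ + a₁ * b₀
          d₂ = a₀ * b₂ + a₁ * b₁ + a₂ * b₀
          d₃ = a₁ * b₂ + a₂ * b₁
          d₄ = a₂ * b₂
          e₁ = d₁ + d₄
          e₂ = d₂ - N * d₄
          e₃ = d₃ - N * d₄
      in d₀ + e₃ , e₁ - N * e₃ , e₂ - N * e₃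

    hornerFrom : Triple Carrier → List Carrier → Triple Carrier → Triple Carrier
    hornerFrom acc []       x = acc
    hornerFrom acc (c ∷ cs) x = hornerFrom (mul acc x ⊕ (c , 0# , 0#)) cs x

    horner : List Carrier → Triple Carrier → Triple Carrier
    horner = hornerFrom one

    norm : Triple Carrier → Carrier
    norm x = determinant (mul x one) (mul x ρ) (mul x (mul ρ ρ))

-- The data attached to n = 2k + 1, as expressions in k over any ring:
-- N = n and a = (n + 3)/2, so that μ = a(1 + ρ) + ρ².
module Family (R : RawRing 0ℓ 0ℓ) (k : RawRing.Carrier R) where
  open RawRing R
  open CubicArithmetic R
  open RawSemiringDefinitions rawSemiring using (_×′_; _^′_)

  N a trμ trμ⁻¹ : Carrier
  N     = 1# + 2 ×′ k
  a     = k + 2 ×′ 1#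
  trμ   = 2 ×′ (k ^′ 2) - 2 ×′ k + 3 ×′ 1#
  trμ⁻¹ = 2 ×′ (k ^′ 3) + 2 ×′ (k ^′ 2) - 6 ×′ k - 1#

  μ μ⁻¹ : Triple Carrier
  μ   = a , a , 1#
  μ⁻¹ = k ^′ 2 - k , 3 ×′ k - 2 ×′ (k ^′ 3) , 1# - k ^′ 2

  μ-charPoly μ⁻¹-charPoly : List Carrier
  μ-charPoly   = - trμ   ∷ trμ⁻¹ ∷ - 1# ∷ []
  μ⁻¹-charPoly = - trμ⁻¹ ∷ trμ   ∷ - 1# ∷ []

module ℚ[ρ]    = CubicArithmetic ℚ.+-*-rawRing
module ℚ[X][ρ] = CubicArithmetic (ℚ[X].rawRing 1)
module Q  = Family ℚ.+-*-rawRing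
module QX = Family (ℚ[X].rawRing 1) (ℚ[X].var Fin.zero)
module Z  = Family ℤ.+-*-rawRing
module ZX = Family (ℤ[X].rawRing 1) (ℤ[X].var Fin.zero)

μ-root : ∀ t → ℚ[ρ].horner (Q.N t) (Q.μ-charPoly t) (Q.μ t) ≡ ℚ[ρ].zero
μ-root t = normalise³-sound (t ∷ []) (ℚ[X][ρ].horner QX.N QX.μ-charPoly QX.μ) ℚ[X][ρ].zero refl

μ⁻¹-root : ∀ t → ℚ[ρ].horner (Q.N t) (Q.μ⁻¹-charPoly t) (Q.μ⁻¹ t) ≡ ℚ[ρ].zero
μ⁻¹-root t = normalise³-sound (t ∷ []) (ℚ[X][ρ].horner QX.N QX.μ⁻¹-charPoly QX.μ⁻¹) ℚ[X][ρ].zero refl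

μ*μ⁻¹≡1 : ∀ t → ℚ[ρ].mul (Q.N t) (Q.μ t) (Q.μ⁻¹ t) ≡ ℚ[ρ].one
μ*μ⁻¹≡1 t = normalise³-sound (t ∷ []) (ℚ[X][ρ].mul QX.N QX.μ QX.μ⁻¹) ℚ[X][ρ].one refl

norm-μ≡1 : ∀ t → ℚ[ρ].norm (Q.N t) (Q.μ t) ≡ 1ℚ
norm-μ≡1 t = normalise-sound (t ∷ []) (ℚ[X][ρ].norm QX.N QX.μ) (ℚ[X].con 1ℚ) refl

N-ℤ→ℚ : ∀ k → ℤ→ℚ (Z.N k) ≡ Q.N (ℤ→ℚ k)
N-ℤ→ℚ k = ℤ→ℚ-⟦⟧ ZX.N (k ∷ [])

a-ℤ→ℚ : ∀ k → ℤ→ℚ (Z.a k) ≡ Q.a (ℤ→ℚ k)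
a-ℤ→ℚ k = ℤ→ℚ-⟦⟧ ZX.a (k ∷ [])

μ-charPoly-ℤ→ℚ : ∀ k → List.map ℤ→ℚ (Z.μ-charPoly k) ≡ Q.μ-charPoly (ℤ→ℚ k)
μ-charPoly-ℤ→ℚ k = ℤ→ℚ-⟦⟧-map ZX.μ-charPoly (k ∷ [])

μ⁻¹-charPoly-ℤ→ℚ : ∀ k → List.map ℤ→ℚ (Z.μ⁻¹-charPoly k) ≡ Q.μ⁻¹-charPoly (ℤ→ℚ k)
μ⁻¹-charPoly-ℤ→ℚ k = ℤ→ℚ-⟦⟧-map ZX.μ⁻¹-charPoly (k ∷ [])

m*2≡m+m : ∀ m → m ℕ.* 2 ≡ m ℕ.+ m
m*2≡m+m = solve-∀

1+m*2+3≡[m+2]*2 : ∀ m → ℕ.suc (m ℕ.* 2) ℕ.+ 3 ≡ (m ℕ.+ 2) ℕ.* 2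
1+m*2+3≡[m+2]*2 = solve-∀

[m*d]/d≡m : ∀ m d → + (m ℕ.* ℕ.suc d) ℚ./ ℕ.suc d ≡ ℕ→ℚ m
[m*d]/d≡m m d = ℚ.fromℚᵘ-cong {mkℚᵘ (+ (m ℕ.* ℕ.suc d)) d} {mkℚᵘ (+ m) 0}
  (*≡* (trans (ℤ.*-identityʳ _) (ℤ.pos-* m (ℕ.suc d))))

UnitOfNormOne : ℕ → K → Set
UnitOfNormOne n x = IsUnitOK n x × normK n x ≡ 1ℚ

module OddCase (k : ℕ) where
  n : ℕ
  n = ℕ.suc (k ℕ.* 2)

  t A : ℚ
  t = ℕ→ℚ k
  A = + (n ℕ.+ 3) ℚ./ 2

  ℕ→ℚn≡N : ℕ→ℚ n ≡ Q.N t
  ℕ→ℚn≡N = trans (cong (λ m → ℕ→ℚ (ℕ.suc m)) (m*2≡m+m k)) (N-ℤ→ℚ (+ k))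

  A≡a : A ≡ Q.a t
  A≡a = begin
    + (n ℕ.+ 3) ℚ./ 2          ≡⟨ cong (λ m → + m ℚ./ 2) (1+m*2+3≡[m+2]*2 k) ⟩
    + ((k ℕ.+ 2) ℕ.* 2) ℚ./ 2  ≡⟨ [m*d]/d≡m (k ℕ.+ 2) 1 ⟩
    ℕ→ℚ (k ℕ.+ 2)              ≡⟨ a-ℤ→ℚ (+ k) ⟩
    Q.a t                      ∎
    where open ≡-Reasoning

  substitute-k : {B : Set} (F : ℚ → Triple ℚ → B) → F (ℕ→ℚ n) (A , A , 1ℚ) ≡ F (Q.N t) (Q.μ t)
  substitute-k F = cong₂ (λ N a → F N (a , a , 1ℚ)) ℕ→ℚn≡N A≡a

  μK-integral : InOK n (μK n)
  μK-integral = Z.μ-charPoly (+ k) , (begin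
    toK (ℚ[ρ].horner (ℕ→ℚ n) (List.map ℤ→ℚ (Z.μ-charPoly (+ k))) (A , A , 1ℚ))
      ≡⟨ substitute-k (λ N x → toK (ℚ[ρ].horner N (List.map ℤ→ℚ (Z.μ-charPoly (+ k))) x)) ⟩
    toK (ℚ[ρ].horner (Q.N t) (List.map ℤ→ℚ (Z.μ-charPoly (+ k))) (Q.μ t))
      ≡⟨ cong (λ cs → toK (ℚ[ρ].horner (Q.N t) cs (Q.μ t))) (μ-charPoly-ℤ→ℚ (+ k)) ⟩
    toK (ℚ[ρ].horner (Q.N t) (Q.μ-charPoly t) (Q.μ t))
      ≡⟨ cong toK (μ-root t) ⟩
    zeroK n ∎)
    where open ≡-Reasoning

  μK⁻¹ : K
  μK⁻¹ = toK (Q.μ⁻¹ t)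

  μK⁻¹-integral : InOK n μK⁻¹
  μK⁻¹-integral = Z.μ⁻¹-charPoly (+ k) ,
    trans (cong₂ (λ N cs → toK (ℚ[ρ].horner N cs (Q.μ⁻¹ t))) ℕ→ℚn≡N (μ⁻¹-charPoly-ℤ→ℚ (+ k)))
          (cong toK (μ⁻¹-root t))

  μK*μK⁻¹≡1 : mulK n (μK n) μK⁻¹ ≡ oneK n
  μK*μK⁻¹≡1 = trans (substitute-k (λ N x → toK (ℚ[ρ].mul N x (Q.μ⁻¹ t)))) (cong toK (μ*μ⁻¹≡1 t))

  normK-μK≡1 : normK n (μK n) ≡ 1ℚ
  normK-μK≡1 = trans (substitute-k ℚ[ρ].norm) (norm-μ≡1 t)

  μK-unitOfNormOne : UnitOfNormOne n (μK n)
  μK-unitOfNormOne = (μK-integral , μK⁻¹ , μK⁻¹-integral , μK*μK⁻¹≡1) , normK-μK≡1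

lemma4p6 : (n : ℕ) → 5 ≤ n → n % 2 ≡ 1 →
    IsUnitOK n (μK n) × normK n (μK n) ≡ 1ℚ
lemma4p6 n _ n-odd =
  subst (λ m → UnitOfNormOne m (μK m)) (sym n≡1+[n/2]*2) (OddCase.μK-unitOfNormOne (n ℕ./ 2))
  where
  n≡1+[n/2]*2 : n ≡ ℕ.suc (n ℕ./ 2 ℕ.* 2)
  n≡1+[n/2]*2 = trans (m≡m%n+[m/n]*n n 2) (cong (ℕ._+ (n ℕ./ 2 ℕ.* 2)) n-odd)
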